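{- Let $G$ be a VC-irreducible graph with minimum vertex cover size $m$. Then every graph in $\mathrm{Par}(G)$ has minimum vertex cover size $m+1$, and for every $k\ge 0$ every graph in $\mathrm{Par}^k(G)$ has minimum vertex cover size $m+k$.
   Context: A connected graph $G=(V,E)$ is VC-irreducible if for every edge $e\in E$ the graph $(V,E\setminus\{e\})$ has strictly smaller minimum vertex cover size than $G$. For a graph $G=(V,E)$, $\mathrm{Par}(G)$ is the set of graphs obtained by adding a new vertex $u\notin V$ together with the edge set $\{\{u,v'\}: v'\in N_G(v)\cup\{v\}\}$ for some vertex $v\in V$ (a parallel extension of $v$), where $N_G(v)$ is the neighborhood of $v$. For a family $\mathcal{G}$, $\mathrm{Par}(\mathcal{G})=\bigcup_{G\in\mathcal{G}}\mathrm{Par}(G)$, $\mathrm{Par}^0(G)=\{G\}$ and $\mathrm{Par}^k(G)=\mathrm{Par}(\mathrm{Par}^{k-1}(G))$. -}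

module Defs where

open import Data.Nat using (ℕ; zero; suc; _+_; _≤_; _<_)
open import Data.Bool using (Bool; true; false; _∧_; _∨_; not)
open import Data.Fin using (Fin; zero; suc; _≟_)
open import Data.Fin.Subset using (Subset; _∈_; ∣_∣)
open import Data.Product using (Σ; _×_; _,_; ∃)
open import Data.Sum using (_⊎_)
open import Relation.Binary.PropositionalEquality using (_≡_)
open import Relation.Nullary.Decidable using (⌊_⌋)

Graph : ℕ → Set
Graph n = Fin n → Fin n → Bool

IsSimple : ∀ {n} → Graph n → Set
IsSimple {n} G = (∀ x y → G x y ≡ G y x) × (∀ x → G x x ≡ false)

data Reach {n} (G : Graph n) : Fin n → Fin n → Set where
  here : ∀ {x} → Reach G x x
  step : ∀ {x y z} → G x y ≡ true → Reach G y z → Reach G x z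

Connected : ∀ {n} → Graph n → Set
Connected G = ∀ x y → Reach G x y

IsVC : ∀ {n} → Graph n → Subset n → Set
IsVC G C = ∀ x y → G x y ≡ true → x ∈ C ⊎ y ∈ C

MinVC : ∀ {n} → Graph n → ℕ → Set
MinVC {n} G m = (Σ (Subset n) λ C → IsVC G C × ∣ C ∣ ≡ m)
              × (∀ C → IsVC G C → m ≤ ∣ C ∣)

deleteEdge : ∀ {n} → Graph n → Fin n → Fin n → Graph n
deleteEdge G a b x y =
  G x y ∧ not ((⌊ x ≟ a ⌋ ∧ ⌊ y ≟ b ⌋) ∨ (⌊ x ≟ b ⌋ ∧ ⌊ y ≟ a ⌋))

VCIrreducible : ∀ {n} → Graph n → Set
VCIrreducible {n} G =
  Connected G ×
  (∀ a b → G a b ≡ true → ∀ m m' → MinVC G m → MinVC (deleteEdge G a b) m' → m' < m)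

-- Parallel extension of v: new vertex (zero) adjacent to N(v) ∪ {v};
-- old vertices x are embedded as suc x.
parExt : ∀ {n} → Graph n → Fin n → Graph (suc n)
parExt G v zero    zero    = false
parExt G v zero    (suc y) = G v y ∨ ⌊ y ≟ v ⌋
parExt G v (suc x) zero    = G v x ∨ ⌊ x ≟ v ⌋
parExt G v (suc x) (suc y) = G x y

data ParK {n} (G : Graph n) : (k : ℕ) → Graph (k + n) → Set where
  par0 : ParK G 0 G
  parS : ∀ {k H} → ParK G k H → (v : Fin (k + n)) → ParK G (suc k) (parExt H v)

-- A cover of the parallel extension of v either contains the new vertex u,
-- and then its old part covers G, or it misses u and so contains the whole
-- closed neighbourhood N[v]; then dropping v still covers G, since every edge
-- at v ends in N(v). Either way it has at least m + 1 vertices, and adding u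
-- to a minimum cover of G gives one of exactly that size. Parallel extensions
-- of simple graphs are simple, so the bound iterates along Par^k.
module Submission where

open import Defs
open import Data.Nat using (ℕ; suc; _+_; _≤_; s≤s)
open import Data.Nat.Properties using (+-identityʳ; +-suc; ≤-trans)
open import Data.Fin using (Fin; zero; suc; _≟_)
open import Data.Fin.Subset using (Subset; _∈_; ∣_∣; inside; outside; _-_)
open import Data.Fin.Subset.Properties using (x∈p∧x≢y⇒x∈p-y; x∈p⇒∣p-x∣<∣p∣)
open import Data.Vec using (_∷_; here; there)
open import Data.Bool using (true; false; _∨_)
open import Data.Bool.Properties using (∨-zeroʳ)
open import Data.Product using (_×_; _,_)
open import Data.Sum using (inj₁; inj₂)
open import Relation.Nullary using (yes; no; does)
open import Relation.Nullary.Decidable using (⌊_⌋; isYes≗does; dec-true)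
open import Relation.Binary.PropositionalEquality
  using (_≡_; refl; sym; trans; cong; subst; module ≡-Reasoning)

module _ {n} (G : Graph n) where

  cover-minus : IsSimple G → (C : Subset n) → IsVC G C →
                (v : Fin n) → (∀ y → G v y ≡ true → y ∈ C) → IsVC G (C - v)
  cover-minus (symmetric , loopless) C cover v N⟨v⟩⊆C x y xy
    with x ≟ v | y ≟ v
  ... | yes refl | yes refl with () ← trans (sym xy) (loopless x)
  ... | yes refl | no y≢v = inj₂ (x∈p∧x≢y⇒x∈p-y (N⟨v⟩⊆C y xy) y≢v)
  ... | no x≢v | yes refl =
        inj₁ (x∈p∧x≢y⇒x∈p-y (N⟨v⟩⊆C x (trans (symmetric v x) xy)) x≢v)
  ... | no x≢v | no y≢v with cover x y xy
  ...   | inj₁ x∈C = inj₁ (x∈p∧x≢y⇒x∈p-y x∈C x≢v)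
  ...   | inj₂ y∈C = inj₂ (x∈p∧x≢y⇒x∈p-y y∈C y≢v)

module _ {n} (G : Graph n) (v : Fin n) where

  v∈N[v] : (G v v ∨ ⌊ v ≟ v ⌋) ≡ true
  v∈N[v] = begin
    G v v ∨ ⌊ v ≟ v ⌋       ≡⟨ cong (G v v ∨_) (isYes≗does (v ≟ v)) ⟩
    G v v ∨ does (v ≟ v)    ≡⟨ cong (G v v ∨_) (dec-true (v ≟ v) refl) ⟩
    G v v ∨ true            ≡⟨ ∨-zeroʳ (G v v) ⟩
    true                    ∎
    where open ≡-Reasoning

  parExt-isSimple : IsSimple G → IsSimple (parExt G v)
  parExt-isSimple (symmetric , loopless) = symmetric′ , loopless′
    where
    symmetric′ : ∀ x y → parExt G v x y ≡ parExt G v y x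
    symmetric′ zero    zero    = refl
    symmetric′ zero    (suc y) = refl
    symmetric′ (suc x) zero    = refl
    symmetric′ (suc x) (suc y) = symmetric x y

    loopless′ : ∀ x → parExt G v x x ≡ false
    loopless′ zero    = refl
    loopless′ (suc x) = loopless x

  parExt-cover : (C : Subset n) → IsVC G C → IsVC (parExt G v) (inside ∷ C)
  parExt-cover C cover zero    (suc y) _  = inj₁ here
  parExt-cover C cover (suc x) zero    _  = inj₂ here
  parExt-cover C cover (suc x) (suc y) xy with cover x y xy
  ... | inj₁ x∈C = inj₁ (there x∈C)
  ... | inj₂ y∈C = inj₂ (there y∈C)

  parExt-cover-old : ∀ b (D : Subset n) → IsVC (parExt G v) (b ∷ D) → IsVC G D
  parExt-cover-old b D cover x y xy with cover (suc x) (suc y) xy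
  ... | inj₁ (there x∈D) = inj₁ x∈D
  ... | inj₂ (there y∈D) = inj₂ y∈D

  parExt-outside-cover⇒N[v]⊆ : (D : Subset n) → IsVC (parExt G v) (outside ∷ D) →
                               ∀ y → (G v y ∨ ⌊ y ≟ v ⌋) ≡ true → y ∈ D
  parExt-outside-cover⇒N[v]⊆ D cover y uy with cover zero (suc y) uy
  ... | inj₂ (there y∈D) = y∈D

  parExt-cover-size : IsSimple G → ∀ m → (∀ C → IsVC G C → m ≤ ∣ C ∣) →
                      ∀ C′ → IsVC (parExt G v) C′ → suc m ≤ ∣ C′ ∣
  parExt-cover-size simple m minimal (inside ∷ D) cover =
    s≤s (minimal D (parExt-cover-old inside D cover))
  parExt-cover-size simple m minimal (outside ∷ D) cover =
    ≤-trans (s≤s (minimal (D - v) D-v-cover)) (x∈p⇒∣p-x∣<∣p∣ v∈D)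
    where
    N[v]⊆D : ∀ y → (G v y ∨ ⌊ y ≟ v ⌋) ≡ true → y ∈ D
    N[v]⊆D = parExt-outside-cover⇒N[v]⊆ D cover

    v∈D : v ∈ D
    v∈D = N[v]⊆D v v∈N[v]

    D-v-cover : IsVC G (D - v)
    D-v-cover = cover-minus G simple D (parExt-cover-old outside D cover) v
                  (λ y vy → N[v]⊆D y (cong (_∨ ⌊ y ≟ v ⌋) vy))

  minVC-parExt : IsSimple G → ∀ m → MinVC G m → MinVC (parExt G v) (suc m)
  minVC-parExt simple m ((C , cover , ∣C∣≡m) , minimal) =
    ((inside ∷ C) , parExt-cover C cover , cong suc ∣C∣≡m) ,
    parExt-cover-size simple m minimal

module _ {n} {G : Graph n} (simple : IsSimple G) where

  ParK-isSimple : ∀ {k H} → ParK G k H → IsSimple H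
  ParK-isSimple par0                 = simple
  ParK-isSimple (parS {H = H} par v) = parExt-isSimple H v (ParK-isSimple par)

  minVC-ParK : ∀ {m} → MinVC G m → ∀ {k H} → ParK G k H → MinVC H (m + k)
  minVC-ParK {m} minVC par0 = subst (MinVC G) (sym (+-identityʳ m)) minVC
  minVC-ParK {m} minVC (parS {k} {H} par v) =
    subst (MinVC (parExt H v)) (sym (+-suc m k))
      (minVC-parExt H v (ParK-isSimple par) (m + k) (minVC-ParK minVC par))

corollary2 : ∀ {n} (G : Graph n) (m : ℕ) → IsSimple G → VCIrreducible G → MinVC G m →
    (∀ (v : Fin n) → MinVC (parExt G v) (suc m)) ×
    (∀ (k : ℕ) (H : Graph (k + n)) → ParK G k H → MinVC H (m + k))
corollary2 G m simple _ minVC =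
  (λ v → minVC-parExt G v simple m minVC) ,
  (λ k H par → minVC-ParK simple minVC par)
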